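{- If $G$ is a graph of diameter $2$ that contains no subgraph isomorphic to $C_3$ and none isomorphic to $C_4$, then $\chi_\mu(G)=\chi_1(G)$.
   Context: All graphs are finite and simple. A geodesic is a shortest path. For $X\subseteq V(G)$, two vertices $x,y\in X$ are $X$-visible if some $x,y$-geodesic has no internal vertex in $X$; $X$ is a mutual-visibility (MV) set if every two of its vertices are $X$-visible. $\chi_\mu(G)$ is the least $k$ such that $V(G)$ can be partitioned into $k$ MV sets. A $(k,1)$-coloring of $G$ is a map $V(G)\to[k]$ such that every vertex has at most one neighbor of its own color; the $1$-defective chromatic number $\chi_1(G)$ is the least $k$ for which $G$ has a $(k,1)$-coloring. -}

module Defs where

open import Data.Nat using (ℕ; zero; suc; _<_; _≤_)
open import Data.Fin using (Fin; toℕ; fromℕ; inject₁)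
import Data.Fin as F
open import Data.Product using (Σ; ∃; _×_; _,_)
open import Data.Sum using (_⊎_)
open import Relation.Nullary using (¬_; Dec)
open import Relation.Binary.PropositionalEquality using (_≡_; _≢_)
open import Function.Bundles using (_⇔_)

record Graph (n : ℕ) : Set₁ where
  field
    Adj    : Fin n → Fin n → Set
    sym    : ∀ {x y} → Adj x y → Adj y x
    irrefl : ∀ {x} → ¬ Adj x x
    dec    : ∀ x y → Dec (Adj x y)
open Graph public

module _ {n : ℕ} (G : Graph n) where

  record Walk (x y : Fin n) (k : ℕ) : Set where
    field
      vtx   : Fin (suc k) → Fin n
      start : vtx F.zero ≡ x
      end   : vtx (fromℕ k) ≡ y
      step  : (i : Fin k) → Adj G (vtx (inject₁ i)) (vtx (F.suc i))
  open Walk public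

  IsGeodesic : {x y : Fin n} {k : ℕ} → Walk x y k → Set
  IsGeodesic {x} {y} {k} _ = ∀ m → m < k → ¬ Walk x y m

  IsInternal : {k : ℕ} → Fin (suc k) → Set
  IsInternal {k} i = (0 < toℕ i) × (toℕ i < k)

  Visible : (Fin n → Set) → Fin n → Fin n → Set
  Visible X x y = Σ ℕ λ k → Σ (Walk x y k) λ w →
    IsGeodesic w × (∀ i → IsInternal {k} i → ¬ X (vtx w i))

  IsMV : (Fin n → Set) → Set
  IsMV X = ∀ x y → X x → X y → Visible X x y

  MVPartition : (k : ℕ) → (Fin n → Fin k) → Set
  MVPartition k c = ∀ (j : Fin k) → IsMV (λ v → c v ≡ j)

  IsChiMu : ℕ → Set
  IsChiMu k = (Σ (Fin n → Fin k) (MVPartition k))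
            × (∀ m → Σ (Fin n → Fin m) (MVPartition m) → k ≤ m)

  IsDefective1 : (k : ℕ) → (Fin n → Fin k) → Set
  IsDefective1 k c = ∀ v u w → Adj G v u → Adj G v w →
    c u ≡ c v → c w ≡ c v → u ≡ w

  IsChi1 : ℕ → Set
  IsChi1 k = (Σ (Fin n → Fin k) (IsDefective1 k))
           × (∀ m → Σ (Fin n → Fin m) (IsDefective1 m) → k ≤ m)

  HasDiameter2 : Set
  HasDiameter2 = (∀ x y → Σ ℕ λ k → (k ≤ 2) × Walk x y k)
               × (Σ (Fin n) λ x → Σ (Fin n) λ y → ∀ k → k ≤ 1 → ¬ Walk x y k)

-- Cycle graph C_m (m ≥ 3) on Fin m: i ~ j iff j ≡ i + 1 (mod m) or i ≡ j + 1 (mod m).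
data CycAdj {m : ℕ} : Fin m → Fin m → Set where
  next  : ∀ i j → suc (toℕ i) ≡ toℕ j → CycAdj i j
  prev  : ∀ i j → suc (toℕ j) ≡ toℕ i → CycAdj i j
  wrapˡ : ∀ i j → toℕ i ≡ 0 → suc (toℕ j) ≡ m → CycAdj i j
  wrapʳ : ∀ i j → toℕ j ≡ 0 → suc (toℕ i) ≡ m → CycAdj i j

ContainsCycle : {n : ℕ} → Graph n → ℕ → Set
ContainsCycle {n} G m = Σ (Fin m → Fin n) λ f →
  (∀ i j → f i ≡ f j → i ≡ j) × (∀ i j → CycAdj i j → Adj G (f i) (f j))

{-# OPTIONS --safe #-}
module Submission where

-- Both colourings are about the same local configuration: a vertex v with two
-- neighbours u, w of its own colour.  With diameter ≤ 2 every same-coloured pair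
-- x, y that is neither equal nor adjacent has a geodesic x z y, and if z had
-- their colour it would be such a v; so 1-defective colour classes are
-- mutual-visibility sets.  Conversely, without C₃ and C₄ the vertices u, w of
-- such a configuration are non-adjacent and v is their only common neighbour,
-- so every u,w-geodesic passes through v and the class of v is not a
-- mutual-visibility set.  Hence the two kinds of colourings coincide, and so do
-- their least numbers of colours.

open import Defs
open import Data.Nat using (ℕ; zero; suc; _≤_; z≤n; s≤s)
import Data.Nat.Properties as ℕ
open import Data.Fin using (Fin; zero; suc; toℕ; fromℕ; inject₁; _≟_)
open import Data.Fin.Properties using (toℕ-injective; toℕ-fromℕ)
open import Data.Vec using (Vec; []; _∷_; lookup)
open import Data.Vec.Relation.Unary.All using ([]; _∷_)
open import Data.Vec.Relation.Unary.AllPairs using ([]; _∷_)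
open import Data.Vec.Relation.Unary.Unique.Propositional using (Unique)
open import Data.Vec.Relation.Unary.Unique.Propositional.Properties using (lookup-injective)
open import Data.Product using (Σ; _×_; _,_; map₂)
open import Data.Empty using (⊥-elim)
open import Relation.Nullary using (¬_; yes; no)
open import Relation.Binary.PropositionalEquality as ≡ using (_≡_; _≢_; refl)
open import Function.Bundles using (_⇔_; mk⇔; Equivalence)

IsLeast : (ℕ → Set) → ℕ → Set
IsLeast P k = P k × (∀ m → P m → k ≤ m)

IsLeast-cong : ∀ {P Q : ℕ → Set} → (∀ m → P m ⇔ Q m) → ∀ k → IsLeast P k ⇔ IsLeast Q k
IsLeast-cong P⇔Q k = mk⇔
  (λ (pk , least) → to (P⇔Q k) pk , λ m qm → least m (from (P⇔Q m) qm))
  (λ (qk , least) → from (P⇔Q k) qk , λ m pm → least m (to (P⇔Q m) pm))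
  where open Equivalence

suc-toℕ≡toℕ⇒inject₁-suc : ∀ {m} (i j : Fin (suc m)) → suc (toℕ i) ≡ toℕ j →
  Σ (Fin m) λ k → inject₁ k ≡ i × suc k ≡ j
suc-toℕ≡toℕ⇒inject₁-suc         zero    (suc zero) refl = zero , refl , refl
suc-toℕ≡toℕ⇒inject₁-suc {suc _} (suc i) (suc j)    e with suc-toℕ≡toℕ⇒inject₁-suc i j (ℕ.suc-injective e)
... | k , refl , refl = suc k , refl , refl

suc-toℕ≡⇒≡fromℕ : ∀ {m} (j : Fin (suc m)) → suc (toℕ j) ≡ suc m → j ≡ fromℕ m
suc-toℕ≡⇒≡fromℕ {m} j e = toℕ-injective (≡.trans (ℕ.suc-injective e) (≡.sym (toℕ-fromℕ m)))

module _ {n : ℕ} (G : Graph n) where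

  adj⇒≢ : ∀ {x y} → Adj G x y → x ≢ y
  adj⇒≢ xy refl = irrefl G xy

  closedPath⇒ContainsCycle : ∀ {m} (vs : Vec (Fin n) (suc m)) → Unique vs →
    (∀ (i : Fin m) → Adj G (lookup vs (inject₁ i)) (lookup vs (suc i))) →
    Adj G (lookup vs (fromℕ m)) (lookup vs zero) →
    ContainsCycle G (suc m)
  closedPath⇒ContainsCycle {m} vs distinct consecutive close = lookup vs , lookup-injective distinct , edge
    where
    edge : ∀ i j → CycAdj i j → Adj G (lookup vs i) (lookup vs j)
    edge i j (next _ _ e) with suc-toℕ≡toℕ⇒inject₁-suc i j e
    ... | k , refl , refl = consecutive k
    edge i j (prev _ _ e) with suc-toℕ≡toℕ⇒inject₁-suc j i e
    ... | k , refl , refl = Graph.sym G (consecutive k)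
    edge i j (wrapˡ _ _ i≡0 j≡m) with toℕ-injective {j = zero} i≡0 | suc-toℕ≡⇒≡fromℕ j j≡m
    ... | refl | refl = Graph.sym G close
    edge i j (wrapʳ _ _ j≡0 i≡m) with toℕ-injective {j = zero} j≡0 | suc-toℕ≡⇒≡fromℕ i i≡m
    ... | refl | refl = close

  triangle⇒C₃ : ∀ {a b c} → Adj G a b → Adj G b c → Adj G c a → ContainsCycle G 3
  triangle⇒C₃ {a} {b} {c} ab bc ca = closedPath⇒ContainsCycle (a ∷ b ∷ c ∷ []) distinct consecutive ca
    where
    distinct : Unique (a ∷ b ∷ c ∷ [])
    distinct = (adj⇒≢ ab ∷ ≡.≢-sym (adj⇒≢ ca) ∷ []) ∷ (adj⇒≢ bc ∷ []) ∷ [] ∷ []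
    consecutive : ∀ i → Adj G (lookup (a ∷ b ∷ c ∷ []) (inject₁ i)) (lookup (a ∷ b ∷ c ∷ []) (suc i))
    consecutive zero       = ab
    consecutive (suc zero) = bc

  square⇒C₄ : ∀ {a b c d} → Adj G a b → Adj G b c → Adj G c d → Adj G d a → a ≢ c → b ≢ d →
    ContainsCycle G 4
  square⇒C₄ {a} {b} {c} {d} ab bc cd da a≢c b≢d =
    closedPath⇒ContainsCycle (a ∷ b ∷ c ∷ d ∷ []) distinct consecutive da
    where
    distinct : Unique (a ∷ b ∷ c ∷ d ∷ [])
    distinct = (adj⇒≢ ab ∷ a≢c ∷ ≡.≢-sym (adj⇒≢ da) ∷ [])
             ∷ (adj⇒≢ bc ∷ b≢d ∷ []) ∷ (adj⇒≢ cd ∷ []) ∷ [] ∷ []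
    consecutive : ∀ i →
      Adj G (lookup (a ∷ b ∷ c ∷ d ∷ []) (inject₁ i)) (lookup (a ∷ b ∷ c ∷ d ∷ []) (suc i))
    consecutive zero             = ab
    consecutive (suc zero)       = bc
    consecutive (suc (suc zero)) = cd

  trivialWalk : ∀ x → Walk G x x 0
  trivialWalk x = record { vtx = λ _ → x ; start = refl ; end = refl ; step = λ () }

  edgeWalk : ∀ {x y} → Adj G x y → Walk G x y 1
  edgeWalk {x} {y} xy = record { vtx = v ; start = refl ; end = refl ; step = λ { zero → xy } }
    where
    v : Fin 2 → Fin n
    v zero       = x
    v (suc zero) = y

  pathWalk₂ : ∀ {x z y} → Adj G x z → Adj G z y → Walk G x y 2
  pathWalk₂ {x} {z} {y} xz zy =
    record { vtx = v ; start = refl ; end = refl ; step = λ { zero → xz ; (suc zero) → zy } }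
    where
    v : Fin 3 → Fin n
    v zero             = x
    v (suc zero)       = z
    v (suc (suc zero)) = y

  walk₀⇒≡ : ∀ {x y} → Walk G x y 0 → x ≡ y
  walk₀⇒≡ p = ≡.trans (≡.sym (start p)) (end p)

  walk₁⇒adj : ∀ {x y} → Walk G x y 1 → Adj G x y
  walk₁⇒adj p = ≡.subst₂ (Adj G) (start p) (end p) (step p zero)

  middle : ∀ {x y} → Walk G x y 2 → Fin n
  middle p = vtx p (suc zero)

  middle-adjˡ : ∀ {x y} (p : Walk G x y 2) → Adj G (middle p) x
  middle-adjˡ p = Graph.sym G (≡.subst (λ t → Adj G t (middle p)) (start p) (step p zero))

  middle-adjʳ : ∀ {x y} (p : Walk G x y 2) → Adj G (middle p) y
  middle-adjʳ p = ≡.subst (Adj G (middle p)) (end p) (step p (suc zero))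

  Diameter≤2 : Set
  Diameter≤2 = ∀ x y → Σ ℕ λ k → (k ≤ 2) × Walk G x y k

  edgeWalk-geodesic : ∀ {x y} (xy : Adj G x y) → IsGeodesic G (edgeWalk xy)
  edgeWalk-geodesic xy zero    _        p = adj⇒≢ xy (walk₀⇒≡ p)
  edgeWalk-geodesic _  (suc _) (s≤s ()) _

  walk₂-geodesic : ∀ {x y} → x ≢ y → ¬ Adj G x y → (p : Walk G x y 2) → IsGeodesic G p
  walk₂-geodesic x≢y _   _ zero          _              q = x≢y (walk₀⇒≡ q)
  walk₂-geodesic _   ¬xy _ (suc zero)    _              q = ¬xy (walk₁⇒adj q)
  walk₂-geodesic _   _   _ (suc (suc _)) (s≤s (s≤s ())) _

  middle-internal : IsInternal G {2} (suc zero)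
  middle-internal = s≤s z≤n , s≤s (s≤s z≤n)

  visible-refl : ∀ X x → Visible G X x x
  visible-refl X x = 0 , trivialWalk x , (λ _ ()) , λ { _ (_ , ()) }

  visible-adj : ∀ X {x y} → Adj G x y → Visible G X x y
  visible-adj X xy = 1 , edgeWalk xy , edgeWalk-geodesic xy , noInternal
    where
    noInternal : ∀ i → IsInternal G {1} i → ¬ X (vtx (edgeWalk xy) i)
    noInternal zero       (() , _)
    noInternal (suc zero) (_ , s≤s ())

  visible-viaMiddle : ∀ X {x y} → x ≢ y → ¬ Adj G x y → (p : Walk G x y 2) → ¬ X (middle p) →
    Visible G X x y
  visible-viaMiddle X x≢y ¬xy p middle∉X = 2 , p , walk₂-geodesic x≢y ¬xy p , noInternal
    where
    noInternal : ∀ i → IsInternal G {2} i → ¬ X (vtx p i)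
    noInternal zero             (() , _)
    noInternal (suc zero)       _ = middle∉X
    noInternal (suc (suc zero)) (_ , s≤s (s≤s ()))

  defective⇒mvPartition : Diameter≤2 → ∀ {k} c → IsDefective1 G k c → MVPartition G k c
  defective⇒mvPartition diam c defective j x y cx≡j cy≡j with x ≟ y
  ... | yes refl = visible-refl (λ t → c t ≡ j) x
  ... | no x≢y with dec G x y
  ...   | yes xy = visible-adj (λ t → c t ≡ j) xy
  ...   | no ¬xy with diam x y
  ...     | zero              , _              , p = ⊥-elim (x≢y (walk₀⇒≡ p))
  ...     | suc zero          , _              , p = ⊥-elim (¬xy (walk₁⇒adj p))
  ...     | suc (suc (suc _)) , s≤s (s≤s ()) , _
  ...     | suc (suc zero)    , _              , p =
    visible-viaMiddle (λ t → c t ≡ j) x≢y ¬xy p middle∉class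
    where
    middle∉class : c (middle p) ≢ j
    middle∉class cm≡j = x≢y (defective (middle p) x y (middle-adjˡ p) (middle-adjʳ p)
      (≡.trans cx≡j (≡.sym cm≡j)) (≡.trans cy≡j (≡.sym cm≡j)))

  module _ (no-C₃ : ¬ ContainsCycle G 3) (no-C₄ : ¬ ContainsCycle G 4) where

    commonNeighbour-internal : ∀ {v u w k} → Adj G v u → Adj G v w → u ≢ w →
      (p : Walk G u w k) → IsGeodesic G p → Σ (Fin (suc k)) λ i → IsInternal G i × vtx p i ≡ v
    commonNeighbour-internal {k = zero} _ _ u≢w p _ = ⊥-elim (u≢w (walk₀⇒≡ p))
    commonNeighbour-internal {k = suc zero} vu vw _ p _ =
      ⊥-elim (no-C₃ (triangle⇒C₃ (Graph.sym G vu) vw (Graph.sym G (walk₁⇒adj p))))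
    commonNeighbour-internal {k = suc (suc (suc _))} vu vw _ _ geodesic =
      ⊥-elim (geodesic 2 (s≤s (s≤s (s≤s z≤n))) (pathWalk₂ (Graph.sym G vu) vw))
    commonNeighbour-internal {v} {k = suc (suc zero)} vu vw u≢w p _ with middle p ≟ v
    ... | yes m≡v = suc zero , middle-internal , m≡v
    ... | no m≢v = ⊥-elim (no-C₄ (square⇒C₄ (Graph.sym G vu) vw (Graph.sym G (middle-adjʳ p))
                                    (middle-adjˡ p) u≢w (≡.≢-sym m≢v)))

    mvPartition⇒defective : ∀ {k} c → MVPartition G k c → IsDefective1 G k c
    mvPartition⇒defective c mv v u w vu vw cu≡cv cw≡cv with u ≟ w
    ... | yes u≡w = u≡w
    ... | no u≢w with mv (c v) u w cu≡cv cw≡cv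
    ...   | _ , p , geodesic , avoids with commonNeighbour-internal vu vw u≢w p geodesic
    ...     | i , internal , pᵢ≡v = ⊥-elim (avoids i internal (≡.cong c pᵢ≡v))

proposition4p11 : {n : ℕ} (G : Graph n) → HasDiameter2 G → ¬ ContainsCycle G 3 → ¬ ContainsCycle G 4 →
    (k : ℕ) → IsChiMu G k ⇔ IsChi1 G k
-- IsChiMu G and IsChi1 G unfold to IsLeast of the existence of the respective colourings.
proposition4p11 G (diam , _) no-C₃ no-C₄ = IsLeast-cong λ m →
  mk⇔ (map₂ (mvPartition⇒defective G no-C₃ no-C₄ _)) (map₂ (defective⇒mvPartition G diam _))
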